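{- Let $BN_1=\{m\in V\colon N_1(m)=N_2(m)\}$ and $h\colon BN_1\to N_1$, $h(m)=N_1(m)$. Then the function $m\mapsto h(m)/m$ on $BN_1$ is not increasing.
   Context: $\phi$ is Euler's totient function, $V=\phi(\mathbb{N})$. For $m\in V$: $N_1(m)=\max\{x\in\mathbb{N}\colon\phi(x)\le m\}$, $N_2(m)=\max\{x\colon\phi(x)=m\}$, and $N_1=\{N_1(m)\colon m\in V\}$. -}

module Defs where

open import Data.Nat using (ℕ; suc; _≤_; _<_; _*_)
open import Data.Nat.Properties using (_≟_)
open import Data.Nat.GCD using (gcd)
open import Data.List using (List; length; filter; upTo; map)
open import Data.Product using (_×_; ∃-syntax)
open import Relation.Binary.PropositionalEquality using (_≡_)

-- Euler's totient: φ n = #{ k ∈ {1,…,n} : gcd k n = 1 }  (φ 0 = 0; only n ≥ 1 is used)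
φ : ℕ → ℕ
φ n = length (filter (λ k → gcd k n ≟ 1) (map suc (upTo n)))

InV : ℕ → Set
InV m = ∃[ x ] (1 ≤ x × φ x ≡ m)

IsN₁ : ℕ → ℕ → Set
IsN₁ m x = 1 ≤ x × φ x ≤ m × (∀ y → 1 ≤ y → φ y ≤ m → y ≤ x)

IsN₂ : ℕ → ℕ → Set
IsN₂ m x = 1 ≤ x × φ x ≡ m × (∀ y → 1 ≤ y → φ y ≡ m → y ≤ x)

InBN₁With : ℕ → ℕ → Set
InBN₁With m x = InV m × IsN₁ m x × IsN₂ m x

{-# OPTIONS --safe #-}
-- Take m = 8 and m' = 12: then N₁ = N₂ = 30 and 42 respectively, and 42/12 < 30/8.
-- Maximality of 30 and 42 is a finite search once φ(n) ≤ c forces n ≤ 2c². That bound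
-- follows along a prime factorisation from φ(pm) ≥ p φ(m) for p ∣ m and
-- φ(pm) ≥ (p - 1) φ(m) for p ∤ m, since p ≤ (p - 1)² once p ≥ 3; the single step where
-- 2 enters without dividing the rest costs the factor 2. Both inequalities come from splitting 1, …, pm into p blocks of length m:
-- a totative k of m gives a totative jm + k of pm unless p ∣ jm + k, which happens for
-- no j when p ∣ m and for at most one j < p when p ∤ m.
module Submission where

open import Defs

open import Data.List using ([]; _∷_; filter; applyUpTo; length)
open import Data.List.Properties using (map-applyUpTo)
open import Data.List.Relation.Unary.All using (All; []; _∷_)
open import Data.Nat
open import Data.Nat.Coprimality using (Coprime; coprime⇒gcd≡1; gcd≡1⇒coprime; coprime-divisor)
open import Data.Nat.Divisibility
open import Data.Nat.GCD using (gcd)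
open import Data.Nat.ListAction using (product)
open import Data.Nat.Primality
  using (Prime; prime[2]; prime⇒irreducible; prime⇒nonZero; prime⇒nonTrivial; euclidsLemma)
open import Data.Nat.Primality.Factorisation using (PrimeFactorisation; factorise)
open import Data.Nat.Properties
open import Algebra.Properties.CommutativeSemigroup +-commutativeSemigroup using (interchange)
open import Data.Nat.Tactic.RingSolver using (solve-∀)
open import Data.Product using (_×_; _,_; ∃-syntax)
open import Data.Sum using (_⊎_; inj₁; inj₂)
open import Function using (_∘_)
open import Relation.Binary.PropositionalEquality
open import Relation.Nullary using (Dec; yes; no; ¬?; contradiction)
open import Relation.Nullary.Decidable using (from-yes; _→-dec_)
open import Relation.Unary using (Decidable)

sumBelow : ℕ → (ℕ → ℕ) → ℕ
sumBelow zero    f = 0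
sumBelow (suc n) f = f 0 + sumBelow n (f ∘ suc)

sumBelow-cong : ∀ n {f g : ℕ → ℕ} → (∀ k → f k ≡ g k) → sumBelow n f ≡ sumBelow n g
sumBelow-cong zero    f≡g = refl
sumBelow-cong (suc n) f≡g = cong₂ _+_ (f≡g 0) (sumBelow-cong n (f≡g ∘ suc))

sumBelow-mono-≤ : ∀ n {f g : ℕ → ℕ} → (∀ k → f k ≤ g k) → sumBelow n f ≤ sumBelow n g
sumBelow-mono-≤ zero    f≤g = z≤n
sumBelow-mono-≤ (suc n) f≤g = +-mono-≤ (f≤g 0) (sumBelow-mono-≤ n (f≤g ∘ suc))

sumBelow-const : ∀ n c → sumBelow n (λ _ → c) ≡ n * c
sumBelow-const zero    c = refl
sumBelow-const (suc n) c = cong (c +_) (sumBelow-const n c)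

sumBelow-distrib-+ : ∀ n (f g : ℕ → ℕ) →
                     sumBelow n (λ k → f k + g k) ≡ sumBelow n f + sumBelow n g
sumBelow-distrib-+ zero    f g = refl
sumBelow-distrib-+ (suc n) f g =
  trans (cong (f 0 + g 0 +_) (sumBelow-distrib-+ n (f ∘ suc) (g ∘ suc)))
        (interchange (f 0) (g 0) _ _)

sumBelow-*-distribˡ : ∀ n c (f : ℕ → ℕ) → sumBelow n (λ k → c * f k) ≡ c * sumBelow n f
sumBelow-*-distribˡ zero    c f = sym (*-zeroʳ c)
sumBelow-*-distribˡ (suc n) c f =
  trans (cong (c * f 0 +_) (sumBelow-*-distribˡ n c (f ∘ suc)))
        (sym (*-distribˡ-+ c (f 0) _))

sumBelow-comm : ∀ a b (h : ℕ → ℕ → ℕ) →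
                sumBelow a (λ j → sumBelow b (h j)) ≡ sumBelow b (λ k → sumBelow a (λ j → h j k))
sumBelow-comm zero    b h = sym (trans (sumBelow-const b 0) (*-zeroʳ b))
sumBelow-comm (suc a) b h =
  trans (cong (sumBelow b (h 0) +_) (sumBelow-comm a b (h ∘ suc)))
        (sym (sumBelow-distrib-+ b (h 0) (λ k → sumBelow a (λ j → h (suc j) k))))

sumBelow-+ : ∀ a b (f : ℕ → ℕ) → sumBelow (a + b) f ≡ sumBelow a f + sumBelow b (λ k → f (a + k))
sumBelow-+ zero    b f = refl
sumBelow-+ (suc a) b f = trans (cong (f 0 +_) (sumBelow-+ a b (f ∘ suc))) (sym (+-assoc (f 0) _ _))

sumBelow-* : ∀ a b (f : ℕ → ℕ) →
             sumBelow (a * b) f ≡ sumBelow a (λ j → sumBelow b (λ k → f (j * b + k)))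
sumBelow-* zero    b f = refl
sumBelow-* (suc a) b f =
  trans (sumBelow-+ b (a * b) f)
        (cong (sumBelow b f +_)
          (trans (sumBelow-* a b (λ i → f (b + i)))
                 (sumBelow-cong a (λ j → sumBelow-cong b (λ k → cong f (sym (+-assoc b (j * b) k)))))))

𝟙 : {P : Set} → Dec P → ℕ
𝟙 (yes _) = 1
𝟙 (no _)  = 0

𝟙-yes : {P : Set} (P? : Dec P) → P → 𝟙 P? ≡ 1
𝟙-yes (yes _) _ = refl
𝟙-yes (no ¬p) p = contradiction p ¬p

𝟙-*-≤ : {P Q R : Set} (P? : Dec P) (Q? : Dec Q) (R? : Dec R) →
        (P → Q → R) → 𝟙 P? * 𝟙 Q? ≤ 𝟙 R?
𝟙-*-≤ (yes p) (yes q) R? f = ≤-reflexive (sym (𝟙-yes R? (f p q)))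
𝟙-*-≤ (yes _) (no _)  R? f = z≤n
𝟙-*-≤ (no _)  Q?      R? f = z≤n

𝟙-*-mono-≤ : {P : Set} (P? : Dec P) {a b : ℕ} → (P → a ≤ b) → 𝟙 P? * a ≤ 𝟙 P? * b
𝟙-*-mono-≤ (yes p) a≤b = *-monoʳ-≤ 1 (a≤b p)
𝟙-*-mono-≤ (no _)  a≤b = z≤n

count : {P : ℕ → Set} → Decidable P → ℕ → ℕ
count P? n = sumBelow n (λ j → 𝟙 (P? j))

length-filter-applyUpTo : ∀ {P : ℕ → Set} (P? : Decidable P) (f : ℕ → ℕ) n →
                          length (filter P? (applyUpTo f n)) ≡ count (P? ∘ f) n
length-filter-applyUpTo P? f zero = refl
length-filter-applyUpTo P? f (suc n) with P? (f 0)
... | yes _ = cong suc (length-filter-applyUpTo P? (f ∘ suc) n)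
... | no _  = length-filter-applyUpTo P? (f ∘ suc) n

count-all : ∀ n {P : ℕ → Set} (P? : Decidable P) → (∀ {j} → j < n → P j) → n ≤ count P? n
count-all zero    P? all = z≤n
count-all (suc n) P? all with P? 0
... | yes _  = s≤s (count-all n (P? ∘ suc) (all ∘ s≤s))
... | no ¬p0 = contradiction (all z<s) ¬p0

count-¬-atMostOne : ∀ n {Q : ℕ → Set} (Q? : Decidable Q) →
                    (∀ {i j} → i < n → j < n → Q i → Q j → i ≡ j) →
                    n ≤ suc (count (¬? ∘ Q?) n)
count-¬-atMostOne zero    Q? unique = z≤n
count-¬-atMostOne (suc n) Q? unique with Q? 0
... | yes q0 = s≤s (count-all n (¬? ∘ Q? ∘ suc)
                     (λ j<n qj → 0≢1+n (unique z<s (s≤s j<n) q0 qj)))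
... | no _   = s≤s (count-¬-atMostOne n (Q? ∘ suc)
                     (λ i<n j<n qi qj → suc-injective (unique (s≤s i<n) (s≤s j<n) qi qj)))

isTotative : (n : ℕ) → Decidable (λ k → gcd (suc k) n ≡ 1)
isTotative n k = gcd (suc k) n ≟ 1

φ-count : ∀ n → φ n ≡ count (isTotative n) n
φ-count n = trans (cong (length ∘ filter (λ k → gcd k n ≟ 1)) (map-applyUpTo (λ k → k) suc n))
                  (length-filter-applyUpTo (λ k → gcd k n ≟ 1) suc n)

prime∤⇒coprime : ∀ {p n} → Prime p → p ∤ n → Coprime n p
prime∤⇒coprime pp p∤n (d∣n , d∣p) with prime⇒irreducible pp d∣p
... | inj₁ d≡1 = d≡1
... | inj₂ refl = contradiction d∣n p∤n

coprime-lift : ∀ {p m a} j → Prime p → Coprime a m → p ∤ j * m + a → Coprime (j * m + a) (p * m)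
coprime-lift {p} {m} {a} j pp a⊥m p∤x {d} (d∣x , d∣pm) = a⊥m (d∣a , d∣m)
  where
  d⊥p : Coprime d p
  d⊥p (e∣d , e∣p) = prime∤⇒coprime pp p∤x (∣-trans e∣d d∣x , e∣p)
  d∣m : d ∣ m
  d∣m = coprime-divisor d⊥p d∣pm
  d∣a : d ∣ a
  d∣a = ∣m+n∣m⇒∣n d∣x (∣n⇒∣m*n j d∣m)

∣∧<⇒≡0 : ∀ {p d} → p ∣ d → d < p → d ≡ 0
∣∧<⇒≡0 {d = zero}  _   _   = refl
∣∧<⇒≡0 {d = suc _} p∣d d<p = contradiction p∣d (>⇒∤ d<p)

linearRoot-unique-≤ : ∀ {p m a i j} → Prime p → p ∤ m → i ≤ j → j < p →
                      p ∣ i * m + a → p ∣ j * m + a → i ≡ j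
linearRoot-unique-≤ {p} {m} {a} {i} pp p∤m i≤j j<p p∣i p∣j with m≤n⇒∃[o]m+o≡n i≤j
... | d , refl = sym (trans (cong (i +_) d≡0) (+-identityʳ i))
  where
  shift : ∀ i d m a → (i + d) * m + a ≡ (i * m + a) + d * m
  shift = solve-∀
  p∣dm : p ∣ d * m
  p∣dm = ∣m+n∣m⇒∣n (subst (p ∣_) (shift i d m a) p∣j) p∣i
  d≡0 : d ≡ 0
  d≡0 with euclidsLemma d m pp p∣dm
  ... | inj₁ p∣d = ∣∧<⇒≡0 p∣d (≤-<-trans (m≤n+m d i) j<p)
  ... | inj₂ p∣m = contradiction p∣m p∤m

nonMultiples : ℕ → ℕ → ℕ → ℕ
nonMultiples p m a = count (λ j → ¬? (p ∣? j * m + a)) p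

nonMultiples-∣ : ∀ {p m a} → Prime p → p ∣ m → Coprime a m → p ≤ nonMultiples p m a
nonMultiples-∣ {p} {m} {a} pp p∣m a⊥m = count-all p _ (λ {j} _ p∣x → p≢1 (a⊥m (p∣a j p∣x , p∣m)))
  where
  p≢1 : p ≢ 1
  p≢1 refl = <-irrefl refl (nonTrivial⇒n>1 p {{prime⇒nonTrivial pp}})
  p∣a : ∀ j → p ∣ j * m + a → p ∣ a
  p∣a j p∣x = ∣m+n∣m⇒∣n p∣x (∣n⇒∣m*n j p∣m)

nonMultiples-∤ : ∀ {p m a} → Prime p → p ∤ m → p ∸ 1 ≤ nonMultiples p m a
nonMultiples-∤ {p} {m} {a} pp p∤m = ∸-monoˡ-≤ 1 (count-¬-atMostOne p (λ j → p ∣? j * m + a) unique)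
  where
  unique : ∀ {i j} → i < p → j < p → p ∣ i * m + a → p ∣ j * m + a → i ≡ j
  unique {i} {j} i<p j<p p∣i p∣j with ≤-total i j
  ... | inj₁ i≤j = linearRoot-unique-≤ pp p∤m i≤j j<p p∣i p∣j
  ... | inj₂ j≤i = sym (linearRoot-unique-≤ pp p∤m j≤i i<p p∣j p∣i)

φ-*prime-≥ : ∀ {p m} c → Prime p → (∀ {a} → Coprime a m → c ≤ nonMultiples p m a) →
             c * φ m ≤ φ (p * m)
φ-*prime-≥ {p} {m} c pp enough = begin
    c * φ m
  ≡⟨ cong (c *_) (φ-count m) ⟩
    c * sumBelow m T
  ≡⟨ sym (sumBelow-*-distribˡ m c T) ⟩
    sumBelow m (λ k → c * T k)
  ≡⟨ sumBelow-cong m (λ k → *-comm c (T k)) ⟩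
    sumBelow m (λ k → T k * c)
  ≤⟨ sumBelow-mono-≤ m (λ k → 𝟙-*-mono-≤ (isTotative m k) (enough ∘ gcd≡1⇒coprime)) ⟩
    sumBelow m (λ k → T k * sumBelow p (B k))
  ≡⟨ sumBelow-cong m (λ k → sym (sumBelow-*-distribˡ p (T k) (B k))) ⟩
    sumBelow m (λ k → sumBelow p (λ j → T k * B k j))
  ≡⟨ sym (sumBelow-comm p m (λ j k → T k * B k j)) ⟩
    sumBelow p (λ j → sumBelow m (λ k → T k * B k j))
  ≤⟨ sumBelow-mono-≤ p (λ j → sumBelow-mono-≤ m (λ k → 𝟙-*-≤ (isTotative m k) (¬? (p ∣? j * m + suc k)) _ (totative-lift j k))) ⟩
    sumBelow p (λ j → sumBelow m (λ k → 𝟙 (isTotative (p * m) (j * m + k))))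
  ≡⟨ sym (sumBelow-* p m (λ i → 𝟙 (isTotative (p * m) i))) ⟩
    count (isTotative (p * m)) (p * m)
  ≡⟨ sym (φ-count (p * m)) ⟩
    φ (p * m) ∎
  where
  open ≤-Reasoning
  T : ℕ → ℕ
  T k = 𝟙 (isTotative m k)
  B : ℕ → ℕ → ℕ
  B k j = 𝟙 (¬? (p ∣? j * m + suc k))
  totative-lift : ∀ j k → gcd (suc k) m ≡ 1 → p ∤ j * m + suc k → gcd (suc (j * m + k)) (p * m) ≡ 1
  totative-lift j k k⊥m p∤x = subst (λ x → gcd x (p * m) ≡ 1) (+-suc (j * m) k)
    (coprime⇒gcd≡1 (coprime-lift j pp (gcd≡1⇒coprime k⊥m) p∤x))

φ-*prime-∣ : ∀ {p m} → Prime p → p ∣ m → p * φ m ≤ φ (p * m)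
φ-*prime-∣ {p} pp p∣m = φ-*prime-≥ p pp (nonMultiples-∣ pp p∣m)

φ-*prime-∤ : ∀ {p m} → Prime p → p ∤ m → (p ∸ 1) * φ m ≤ φ (p * m)
φ-*prime-∤ {p} pp p∤m = φ-*prime-≥ (p ∸ 1) pp (λ _ → nonMultiples-∤ pp p∤m)

SquareTotientBound : ℕ → ℕ → Set
SquareTotientBound g n = n ≤ g * (φ n * φ n)

squareBound-scale : ∀ g c p m → p ≤ c * c → c * φ m ≤ φ (p * m) →
                    SquareTotientBound g m → SquareTotientBound g (p * m)
squareBound-scale g c p m p≤c² cφm≤φpm bound = begin
    p * m
  ≤⟨ *-mono-≤ p≤c² bound ⟩
    (c * c) * (g * (φ m * φ m))
  ≡⟨ rearrange c g (φ m) ⟩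
    g * ((c * φ m) * (c * φ m))
  ≤⟨ *-monoʳ-≤ g (*-mono-≤ cφm≤φpm cφm≤φpm) ⟩
    g * (φ (p * m) * φ (p * m)) ∎
  where
  open ≤-Reasoning
  rearrange : ∀ c g f → (c * c) * (g * (f * f)) ≡ g * ((c * f) * (c * f))
  rearrange = solve-∀

≤-square-pred : ∀ {p} → 3 ≤ p → p ≤ (p ∸ 1) * (p ∸ 1)
≤-square-pred {suc (suc (suc r))} (s≤s (s≤s (s≤s _))) =
  ≤-trans (m≤m+n (3 + r) _) (≤-reflexive (sym (expand r)))
  where
  expand : ∀ r → (2 + r) * (2 + r) ≡ (3 + r) + (1 + 3 * r + r * r)
  expand = solve-∀

prime≢2⇒3≤ : ∀ {p} → Prime p → p ≢ 2 → 3 ≤ p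
prime≢2⇒3≤ {p} pp p≢2 = ≤∧≢⇒< (nonTrivial⇒n>1 p {{prime⇒nonTrivial pp}}) (p≢2 ∘ sym)

squareBound-*prime : ∀ g {p m} → Prime p → p ∣ m ⊎ 3 ≤ p →
                     SquareTotientBound g m → SquareTotientBound g (p * m)
squareBound-*prime g {p} {m} pp p∣m⊎3≤p bound with p ∣? m | p∣m⊎3≤p
... | yes p∣m | _        = squareBound-scale g p p m (m≤m*n p p {{prime⇒nonZero pp}}) (φ-*prime-∣ pp p∣m) bound
... | no p∤m  | inj₁ p∣m = contradiction p∣m p∤m
... | no p∤m  | inj₂ 3≤p = squareBound-scale g (p ∸ 1) p m (≤-square-pred 3≤p) (φ-*prime-∤ pp p∤m) bound

squareBound-double : ∀ {m} → SquareTotientBound 1 m → 2 ∤ m → SquareTotientBound 2 (2 * m)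
squareBound-double {m} bound 2∤m = *-monoʳ-≤ 2 (begin
    m
  ≤⟨ bound ⟩
    1 * (φ m * φ m)
  ≡⟨ *-identityˡ _ ⟩
    φ m * φ m
  ≤⟨ *-mono-≤ φm≤φ2m φm≤φ2m ⟩
    φ (2 * m) * φ (2 * m) ∎)
  where
  open ≤-Reasoning
  φm≤φ2m : φ m ≤ φ (2 * m)
  φm≤φ2m = ≤-trans (≤-reflexive (sym (*-identityˡ (φ m)))) (φ-*prime-∤ prime[2] 2∤m)

squareBound-oddProduct : ∀ {as} → All Prime as → 2 ∤ product as → SquareTotientBound 1 (product as)
squareBound-oddProduct []                          _   = s≤s z≤n
squareBound-oddProduct {p ∷ as} (pp ∷ primes) odd =
  squareBound-*prime 1 pp (inj₂ (prime≢2⇒3≤ pp p≢2)) (squareBound-oddProduct primes (odd ∘ ∣n⇒∣m*n p))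
  where
  p≢2 : p ≢ 2
  p≢2 refl = odd (m∣m*n (product as))

squareBound-product : ∀ {as} → All Prime as → SquareTotientBound 2 (product as)
squareBound-product []                          = s≤s z≤n
squareBound-product {p ∷ as} (pp ∷ primes) with p ∣? product as | p ≟ 2
... | yes p∣m | _        = squareBound-*prime 2 pp (inj₁ p∣m) (squareBound-product primes)
... | no p∤m  | yes refl = squareBound-double (squareBound-oddProduct primes p∤m) p∤m
... | no _    | no p≢2   = squareBound-*prime 2 pp (inj₂ (prime≢2⇒3≤ pp p≢2)) (squareBound-product primes)

≤-twice-φ² : ∀ n .{{_ : NonZero n}} → n ≤ 2 * (φ n * φ n)
≤-twice-φ² n = subst (SquareTotientBound 2) (sym isFactorisation) (squareBound-product factorsPrime)
  where open PrimeFactorisation (factorise n)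

φ≤⇒≤ : ∀ {n c} → 1 ≤ n → φ n ≤ c → n ≤ 2 * (c * c)
φ≤⇒≤ {n} 1≤n φn≤c =
  ≤-trans (≤-twice-φ² n {{>-nonZero 1≤n}}) (*-monoʳ-≤ 2 (*-mono-≤ φn≤c φn≤c))

maximalUpTo? : ∀ m x → Dec (∀ {y} → y < suc (2 * (m * m)) → φ y ≤ m → y ≤ x)
maximalUpTo? m x = allUpTo? (λ y → φ y ≤? m →-dec y ≤? x) (suc (2 * (m * m)))

isN₁-bySearch : ∀ {m x} → 1 ≤ x → φ x ≤ m →
                (∀ {y} → y < suc (2 * (m * m)) → φ y ≤ m → y ≤ x) → IsN₁ m x
isN₁-bySearch 1≤x φx≤m search = 1≤x , φx≤m , λ y 1≤y φy≤m → search (s≤s (φ≤⇒≤ 1≤y φy≤m)) φy≤m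

inBN₁With : ∀ {m x} → φ x ≡ m → IsN₁ m x → InBN₁With m x
inBN₁With {x = x} φx≡m isN₁@(1≤x , _ , maximal) =
  (x , 1≤x , φx≡m) , isN₁ , (1≤x , φx≡m , λ y 1≤y φy≡m → maximal y 1≤y (≤-reflexive φy≡m))

proposition2p15 : ∃[ m ] ∃[ m' ] ∃[ a ] ∃[ a' ]
    (m < m' × InBN₁With m a × InBN₁With m' a' × a' * m < a * m')
proposition2p15 =
  8 , 12 , 30 , 42 , from-yes (8 <? 12) ,
  inBN₁With refl (isN₁-bySearch (s≤s z≤n) ≤-refl (from-yes (maximalUpTo? 8 30))) ,
  inBN₁With refl (isN₁-bySearch (s≤s z≤n) ≤-refl (from-yes (maximalUpTo? 12 42))) ,
  from-yes (42 * 8 <? 30 * 12)
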